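{- Let $p$ be a prime and $a$ a positive integer. The player can win the rotating-table game with parameters $(n, m) = (p^a, p)$.
   Context: The rotating-table game with parameters $(n,m)$: $n$ counters lie on the vertices (positions $1,\dots,n$, fixed from the player's perspective) of a regular $n$-gon table, each showing an element of $\mathbb{Z}_m$; the initial configuration in $\mathbb{Z}_m^n$ is arbitrary and unknown to the blindfolded player, who receives no information. Each turn the player makes a move $y \in \mathbb{Z}_m^n$, adding $y_i$ to the counter at position $i$; then the table is rotated by an arbitrary (adversarially chosen) rotation, i.e. the counters are cyclically shifted by any amount (possibly zero). A strategy is a fixed finite sequence of moves. The player "can win" if some finite sequence of moves guarantees that, for every initial configuration and every choice of rotations, at some point (initially or after some move) all counters simultaneously show $0$. -}

module Defs where

open import Data.Nat using (ℕ; zero; suc; _+_; _^_; NonZero)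
open import Data.Nat.DivMod using (_mod_)
open import Data.Fin using (Fin; toℕ)
open import Data.List using (List; []; _∷_)
open import Data.Product using (Σ)
open import Data.List.Relation.Unary.Any using (Any)
open import Relation.Binary.PropositionalEquality using (_≡_)

-- A configuration of the (n,m) game: the value in ℤ_m (represented as Fin m)
-- shown by the counter at (fixed) position i : Fin n.
Config : ℕ → ℕ → Set
Config n m = Fin n → Fin m

Move : ℕ → ℕ → Set
Move = Config

_+ₘ_ : ∀ {m} .{{_ : NonZero m}} → Fin m → Fin m → Fin m
_+ₘ_ {m} a b = (toℕ a + toℕ b) mod m

applyMove : ∀ {n m} .{{_ : NonZero m}} → Config n m → Move n m → Config n m
applyMove c y i = c i +ₘ y i

rotate : ∀ {n m} .{{_ : NonZero n}} → Fin n → Config n m → Config n m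
rotate {n} r c i = c ((toℕ i + toℕ r) mod n)

AllZero : ∀ {n m} → Config n m → Set
AllZero {n} c = ∀ (i : Fin n) → toℕ (c i) ≡ 0

states : ∀ {n m} .{{_ : NonZero n}} .{{_ : NonZero m}} →
         Config n m → List (Move n m) → (ℕ → Fin n) → List (Config n m)
states c []       rots = c ∷ []
states c (y ∷ ys) rots = c ∷ states (rotate (rots 0) (applyMove c y)) ys (λ k → rots (suc k))

CanWin : (n m : ℕ) .{{_ : NonZero n}} .{{_ : NonZero m}} → Set
CanWin n m = Σ (List (Move n m)) λ ys →
  ∀ (c : Config n m) (rots : ℕ → Fin n) → Any AllZero (states c ys rots)

-- Read a configuration as an n-periodic sequence f of residues mod p, where n = p ^ a, and
-- let Δ f i = f (i + 1) − f i, computed in ℕ as f (i + 1) + (p − 1) · f i. Adding a move is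
-- linear and a rotation is a shift, and Δ commutes with both; hence "Δ^k f is constant" is
-- preserved by every move y with Δ^k y = 0 and by every rotation. Modulo p the binomial
-- coefficients n C t with 0 < t < n vanish, so Δ^n f i = f (i + n) − f i = 0 for every
-- configuration. By induction on k, a strategy wins from every configuration with Δ^k f = 0:
-- for k + 1, play p copies of the strategy for k separated by p − 1 moves b with Δ^(k+1) b = 0
-- and Δ^k b = 1. If Δ^(k+1) f = 0 then Δ^k f is a constant, unchanged by the strategy for k and
-- raised by one by each b, so it is 0 before one of the copies.

module Submission where

open import Level using (0ℓ)
open import Data.Nat
open import Data.Nat.Properties
open import Data.Nat.DivMod
open import Data.Nat.Divisibility
open import Data.Nat.Combinatorics using (_C_; nCn≡1; nC1≡n; nCk+nC[k+1]≡[n+1]C[k+1]; k>n⇒nCk≡0)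
open import Data.Nat.Primality using (Prime; euclidsLemma; prime⇒nonZero)
open import Data.Nat.GeneralisedArithmetic using (fold; fold-+)
open import Data.Nat.Tactic.RingSolver using (solve-∀)
open import Data.Fin as Fin using (Fin; toℕ; fromℕ; inject₁)
open import Data.Fin.Properties using (toℕ<n; toℕ-fromℕ; toℕ-inject₁; toℕ-fromℕ<; toℕ-injective)
open import Data.Vec.Functional using (Vector)
open import Data.List using (List; []; _∷_; _++_; length)
open import Data.List.Relation.Unary.Any using (Any; here; there)
open import Data.List.Relation.Unary.All as All using (All; []; _∷_)
open import Data.List.Relation.Unary.All.Properties using (++⁺)
open import Data.Product using (_,_)
open import Data.Sum using (inj₁; inj₂)
open import Relation.Nullary using (¬_; yes; no; contradiction)
open import Relation.Binary using (Rel; Setoid; IsEquivalence)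
open import Relation.Binary.PropositionalEquality
import Relation.Binary.Construct.On as On
import Relation.Binary.Reasoning.Setoid
open import Algebra.Properties.Semiring.Sum +-*-semiring
  using (sum; sum-syntax; ∑-distrib-+; *-distribˡ-sum; sum-cong-≗; sum-replicate-zero; sum-init-last)

open import Defs

[1+k]*[1+n]C[1+k]≡[1+n]*nCk : ∀ n k → suc k * (suc n C suc k) ≡ suc n * (n C k)
[1+k]*[1+n]C[1+k]≡[1+n]*nCk zero    zero    = refl
[1+k]*[1+n]C[1+k]≡[1+n]*nCk zero    (suc k) = *-zeroʳ (2 + k)
[1+k]*[1+n]C[1+k]≡[1+n]*nCk (suc n) zero    = begin
  1 * ((2 + n) C 1)   ≡⟨ *-identityˡ _ ⟩
  (2 + n) C 1         ≡⟨ nC1≡n (2 + n) ⟩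
  2 + n               ≡⟨ *-identityʳ (2 + n) ⟨
  (2 + n) * 1         ∎
  where open ≡-Reasoning
[1+k]*[1+n]C[1+k]≡[1+n]*nCk (suc n) (suc k) = begin
  (2 + k) * ((2 + n) C (2 + k))
    ≡⟨ cong ((2 + k) *_) (nCk+nC[k+1]≡[n+1]C[k+1] (suc n) (suc k)) ⟨
  (2 + k) * (A + B)
    ≡⟨ expand k A B ⟩
  A + ((1 + k) * A + (2 + k) * B)
    ≡⟨ cong₂ (λ x y → A + (x + y)) ([1+k]*[1+n]C[1+k]≡[1+n]*nCk n k)
                                    ([1+k]*[1+n]C[1+k]≡[1+n]*nCk n (suc k)) ⟩
  A + ((1 + n) * (n C k) + (1 + n) * (n C suc k))
    ≡⟨ cong (A +_) (*-distribˡ-+ (suc n) (n C k) (n C suc k)) ⟨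
  A + (1 + n) * (n C k + n C suc k)
    ≡⟨ cong (λ x → A + (1 + n) * x) (nCk+nC[k+1]≡[n+1]C[k+1] n k) ⟩
  (2 + n) * A ∎
  where
  open ≡-Reasoning
  A = suc n C suc k
  B = suc n C suc (suc k)
  expand : ∀ k a b → (2 + k) * (a + b) ≡ a + ((1 + k) * a + (2 + k) * b)
  expand = solve-∀

p^j∣m*n∧p∤n⇒p^j∣m : ∀ {p} j {m n} → Prime p → ¬ p ∣ n → p ^ j ∣ m * n → p ^ j ∣ m
p^j∣m*n∧p∤n⇒p^j∣m zero _ _ _ = 1∣ _
p^j∣m*n∧p∤n⇒p^j∣m {p} (suc j) {m} {n} pp p∤n p^[1+j]∣mn
  with euclidsLemma m n pp (∣-trans (m∣m*n (p ^ j)) p^[1+j]∣mn)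
... | inj₂ p∣n = contradiction p∣n p∤n
... | inj₁ (divides m′ refl) =
  subst (p ^ suc j ∣_) (*-comm p m′) (*-monoʳ-∣ p (p^j∣m*n∧p∤n⇒p^j∣m j pp p∤n p^j∣m′n))
  where
  instance _ = prime⇒nonZero pp
  p^j∣m′n : p ^ j ∣ m′ * n
  p^j∣m′n = *-cancelˡ-∣ p (subst (p ^ suc j ∣_) (rearrange m′ p n) p^[1+j]∣mn)
    where
    rearrange : ∀ m′ p n → m′ * p * n ≡ p * (m′ * n)
    rearrange = solve-∀

-- p ^ a divides k * (n C k) = n * ((n − 1) C (k − 1)) but not k, so p divides n C k.
p∣nCk : ∀ {p} a {n k} → Prime p → p ^ a ∣ n → 0 < k → k < p ^ a → p ∣ n C k
p∣nCk a {zero}  {suc k} pp _ _ _ = _ ∣0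
p∣nCk {p} a {suc n} {suc k} pp p^a∣n _ k<p^a with p ∣? (suc n C suc k)
... | yes p∣C = p∣C
... | no  p∤C = contradiction (∣⇒≤ p^a∣1+k) (<⇒≱ k<p^a)
  where
  p^a∣1+k : p ^ a ∣ suc k
  p^a∣1+k = p^j∣m*n∧p∤n⇒p^j∣m a pp p∤C
    (subst (p ^ a ∣_) (sym ([1+k]*[1+n]C[1+k]≡[1+n]*nCk n k)) (∣m⇒∣m*n (n C k) p^a∣n))

m∣m^n : ∀ m n .{{_ : NonZero n}} → m ∣ m ^ n
m∣m^n m (suc n) = m∣m*n (m ^ n)

∣-∑ : ∀ {d N} (g : Vector ℕ N) → (∀ t → d ∣ g t) → d ∣ sum g
∣-∑ {d} {zero}  g _   = d ∣0
∣-∑ {N = suc N} g d∣g =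
  ∣m∣n⇒∣m+n (d∣g Fin.zero) (∣-∑ (λ t → g (Fin.suc t)) (λ t → d∣g (Fin.suc t)))

module Congruence (d : ℕ) .{{_ : NonZero d}} where

  infix 4 _≈_
  -- Opaque so that x ≈ y is not unfolded to x % d ≡ y % d, which would prevent Agda from
  -- inferring the implicit arguments of the lemmas below.
  opaque
    _≈_ : Rel ℕ 0ℓ
    x ≈ y = x % d ≡ y % d

  opaque
    unfolding _≈_

    ≈-isEquivalence : IsEquivalence _≈_
    ≈-isEquivalence = On.isEquivalence (_% d) isEquivalence

    +-cong : ∀ {a a′ b b′} → a ≈ a′ → b ≈ b′ → a + b ≈ a′ + b′
    +-cong {a} {a′} {b} {b′} a≈a′ b≈b′ = begin
      (a + b) % d             ≡⟨ %-distribˡ-+ a b d ⟩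
      (a % d + b % d) % d     ≡⟨ cong₂ (λ x y → (x + y) % d) a≈a′ b≈b′ ⟩
      (a′ % d + b′ % d) % d   ≡⟨ %-distribˡ-+ a′ b′ d ⟨
      (a′ + b′) % d           ∎
      where open ≡-Reasoning

    *-cong : ∀ {a a′ b b′} → a ≈ a′ → b ≈ b′ → a * b ≈ a′ * b′
    *-cong {a} {a′} {b} {b′} a≈a′ b≈b′ = begin
      (a * b) % d             ≡⟨ %-distribˡ-* a b d ⟩
      (a % d * (b % d)) % d   ≡⟨ cong₂ (λ x y → (x * y) % d) a≈a′ b≈b′ ⟩
      (a′ % d * (b′ % d)) % d ≡⟨ %-distribˡ-* a′ b′ d ⟨
      (a′ * b′) % d           ∎
      where open ≡-Reasoning

    ∣⇒≈0 : ∀ {a} → d ∣ a → a ≈ 0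
    ∣⇒≈0 {a} d∣a = trans (n∣m⇒m%n≡0 a d d∣a) (sym (m<n⇒m%n≡m (>-nonZero⁻¹ d)))

    %-≈ : ∀ a → a % d ≈ a
    %-≈ a = m%n%n≡m%n a d

    ≈⇒≡ : ∀ {a b} → a < d → b < d → a ≈ b → a ≡ b
    ≈⇒≡ a<d b<d a≈b = trans (sym (m<n⇒m%n≡m a<d)) (trans a≈b (m<n⇒m%n≡m b<d))

  ≈-setoid : Setoid 0ℓ 0ℓ
  ≈-setoid = record { isEquivalence = ≈-isEquivalence }

  module ≈-Reasoning = Relation.Binary.Reasoning.Setoid ≈-setoid

  open IsEquivalence ≈-isEquivalence public
    using () renaming (refl to ≈-refl; trans to ≈-trans; reflexive to ≡⇒≈)

Seq : Set
Seq = ℕ → ℕ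

Periodic : ℕ → Seq → Set
Periodic n f = ∀ i → f (i + n) ≡ f i

periodic-+* : ∀ {n f} → Periodic n f → ∀ i k → f (i + k * n) ≡ f i
periodic-+* {n} {f} f-periodic i zero    = cong f (+-identityʳ i)
periodic-+* {n} {f} f-periodic i (suc k) = begin
  f (i + (n + k * n))   ≡⟨ cong f (regroup i n (k * n)) ⟩
  f (i + k * n + n)     ≡⟨ f-periodic (i + k * n) ⟩
  f (i + k * n)         ≡⟨ periodic-+* f-periodic i k ⟩
  f i                   ∎
  where
  open ≡-Reasoning
  regroup : ∀ i n x → i + (n + x) ≡ i + x + n
  regroup = solve-∀

periodic-% : ∀ {n f} .{{_ : NonZero n}} → Periodic n f → ∀ i → f (i % n) ≡ f i
periodic-% {n} {f} f-periodic i = begin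
  f (i % n)                 ≡⟨ periodic-+* f-periodic (i % n) (i / n) ⟨
  f (i % n + i / n * n)     ≡⟨ cong f (m≡m%n+[m/n]*n i n) ⟨
  f i                       ∎
  where open ≡-Reasoning

module FiniteDifference (q : ℕ) where

  Δ : Seq → Seq
  Δ f i = f (suc i) + q * f i

  Δ^ : ℕ → Seq → Seq
  Δ^ k f = fold f Δ k

  weight : ℕ → ℕ → ℕ
  weight k t = (k C t) * q ^ (k ∸ t)

  weight-suc-zero : ∀ k → weight (suc k) 0 ≡ q * weight k 0
  weight-suc-zero k = trans (*-identityˡ _) (cong (q *_) (sym (*-identityˡ _)))

  weight-pascal : ∀ k t → weight k t + q * weight k (suc t) ≡ weight (suc k) (suc t)
  weight-pascal k t with t <? k
  ... | yes t<k = begin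
    (k C t) * q ^ (k ∸ t) + q * ((k C suc t) * q ^ (k ∸ suc t))
      ≡⟨ cong (λ e → (k C t) * q ^ e + q * ((k C suc t) * q ^ (k ∸ suc t))) (+-∸-assoc 1 t<k) ⟩
    (k C t) * (q * q ^ (k ∸ suc t)) + q * ((k C suc t) * q ^ (k ∸ suc t))
      ≡⟨ factor (k C t) (k C suc t) q (q ^ (k ∸ suc t)) ⟩
    ((k C t) + (k C suc t)) * (q * q ^ (k ∸ suc t))
      ≡⟨ cong₂ (λ c e → c * q ^ e) (nCk+nC[k+1]≡[n+1]C[k+1] k t) (sym (+-∸-assoc 1 t<k)) ⟩
    (suc k C suc t) * q ^ (k ∸ t) ∎
    where
    open ≡-Reasoning
    factor : ∀ a b q x → a * (q * x) + q * (b * x) ≡ (a + b) * (q * x)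
    factor = solve-∀
  ... | no t≮k = begin
    (k C t) * q ^ (k ∸ t) + q * ((k C suc t) * q ^ (k ∸ suc t))
      ≡⟨ cong (λ c → (k C t) * q ^ (k ∸ t) + q * (c * q ^ (k ∸ suc t))) kC[1+t]≡0 ⟩
    (k C t) * q ^ (k ∸ t) + q * (0 * q ^ (k ∸ suc t))
      ≡⟨ vanish (k C t) (q ^ (k ∸ t)) q (q ^ (k ∸ suc t)) ⟩
    ((k C t) + 0) * q ^ (k ∸ t)
      ≡⟨ cong (λ c → ((k C t) + c) * q ^ (k ∸ t)) kC[1+t]≡0 ⟨
    ((k C t) + (k C suc t)) * q ^ (k ∸ t)
      ≡⟨ cong (_* q ^ (k ∸ t)) (nCk+nC[k+1]≡[n+1]C[k+1] k t) ⟩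
    (suc k C suc t) * q ^ (k ∸ t) ∎
    where
    open ≡-Reasoning
    kC[1+t]≡0 : (k C suc t) ≡ 0
    kC[1+t]≡0 = k>n⇒nCk≡0 (s≤s (≮⇒≥ t≮k))
    vanish : ∀ a x q y → a * x + q * (0 * y) ≡ (a + 0) * x
    vanish = solve-∀

  -- Any number N > k of terms may be summed, since the extra weights vanish; this keeps the
  -- induction step free of boundary terms.
  Δ^-expansion : ∀ k {N} → k < N → ∀ f i →
                 Δ^ k f i ≡ ∑[ t < N ] (weight k (toℕ t) * f (i + toℕ t))
  Δ^-expansion zero {suc N} _ f i = sym (begin
    1 * f (i + 0) + ∑[ t < N ] 0 ≡⟨ cong₂ _+_ (*-identityˡ _) (sum-replicate-zero N) ⟩
    f (i + 0) + 0                 ≡⟨ +-identityʳ _ ⟩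
    f (i + 0)                     ≡⟨ cong f (+-identityʳ i) ⟩
    f i                           ∎)
    where open ≡-Reasoning
  Δ^-expansion (suc k) {suc N} (s≤s k<N) f i = begin
    Δ^ k f (suc i) + q * Δ^ k f i
      ≡⟨ cong₂ (λ x y → x + q * y) (Δ^-expansion k k<N f (suc i))
                                   (Δ^-expansion k (m<n⇒m<1+n k<N) f i) ⟩
    ∑[ t < N ] a (toℕ t) + q * (h + ∑[ t < N ] b (toℕ t))
      ≡⟨ cong (∑[ t < N ] a (toℕ t) +_) (*-distribˡ-+ q h _) ⟩
    ∑[ t < N ] a (toℕ t) + (q * h + q * ∑[ t < N ] b (toℕ t))
      ≡⟨ cong (λ y → ∑[ t < N ] a (toℕ t) + (q * h + y)) (*-distribˡ-sum {N} q (λ t → b (toℕ t))) ⟩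
    ∑[ t < N ] a (toℕ t) + (q * h + ∑[ t < N ] (q * b (toℕ t)))
      ≡⟨ swap (∑[ t < N ] a (toℕ t)) (q * h) _ ⟩
    q * h + (∑[ t < N ] a (toℕ t) + ∑[ t < N ] (q * b (toℕ t)))
      ≡⟨ cong (q * h +_) (∑-distrib-+ {N} (λ t → a (toℕ t)) (λ t → q * b (toℕ t))) ⟨
    q * h + ∑[ t < N ] (a (toℕ t) + q * b (toℕ t))
      ≡⟨ cong₂ _+_ (trans (cong (_* f (i + 0)) (weight-suc-zero k)) (*-assoc q _ _))
                   (sum-cong-≗ {N} (λ t → combine (toℕ t))) ⟨
    weight (suc k) 0 * f (i + 0) + ∑[ t < N ] (weight (suc k) (suc (toℕ t)) * f (i + suc (toℕ t))) ∎
    where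
    open ≡-Reasoning
    a b : ℕ → ℕ
    a t = weight k t * f (suc i + t)
    b t = weight k (suc t) * f (i + suc t)
    h : ℕ
    h = weight k 0 * f (i + 0)
    swap : ∀ x y z → x + (y + z) ≡ y + (x + z)
    swap = solve-∀
    combine : ∀ t → weight (suc k) (suc t) * f (i + suc t) ≡ a t + q * b t
    combine t = sym (begin
      weight k t * f (suc i + t) + q * (weight k (suc t) * f (i + suc t))
        ≡⟨ cong (λ j → weight k t * f j + q * (weight k (suc t) * f (i + suc t))) (+-suc i t) ⟨
      weight k t * f (i + suc t) + q * (weight k (suc t) * f (i + suc t))
        ≡⟨ cong (weight k t * f (i + suc t) +_) (*-assoc q _ _) ⟨
      weight k t * f (i + suc t) + q * weight k (suc t) * f (i + suc t)
        ≡⟨ *-distribʳ-+ (f (i + suc t)) (weight k t) _ ⟨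
      (weight k t + q * weight k (suc t)) * f (i + suc t)
        ≡⟨ cong (_* f (i + suc t)) (weight-pascal k t) ⟩
      weight (suc k) (suc t) * f (i + suc t) ∎)

  Δ^-compose : ∀ k l f → Δ^ (k + l) f ≡ Δ^ k (Δ^ l f)
  Δ^-compose k l f = fold-+ f Δ k

  Δ^-shift : ∀ k f s i → Δ^ k (λ j → f (j + s)) i ≡ Δ^ k f (i + s)
  Δ^-shift zero    f s i = refl
  Δ^-shift (suc k) f s i = cong₂ (λ x y → x + q * y) (Δ^-shift k f s (suc i)) (Δ^-shift k f s i)

  Δ^-ext : ∀ k {f g} → (∀ i → f i ≡ g i) → ∀ i → Δ^ k f i ≡ Δ^ k g i
  Δ^-ext zero    f≡g i = f≡g i
  Δ^-ext (suc k) f≡g i = cong₂ (λ x y → x + q * y) (Δ^-ext k f≡g (suc i)) (Δ^-ext k f≡g i)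

  Δ^-periodic : ∀ k {n f} → Periodic n f → Periodic n (Δ^ k f)
  Δ^-periodic k {n} {f} f-periodic i = trans (sym (Δ^-shift k f n i)) (Δ^-ext k f-periodic i)

  Δ^-distrib-+ : ∀ k f g i → Δ^ k (λ j → f j + g j) i ≡ Δ^ k f i + Δ^ k g i
  Δ^-distrib-+ zero    f g i = refl
  Δ^-distrib-+ (suc k) f g i = begin
    Δ^ k h (suc i) + q * Δ^ k h i
      ≡⟨ cong₂ (λ x y → x + q * y) (Δ^-distrib-+ k f g (suc i)) (Δ^-distrib-+ k f g i) ⟩
    (Δ^ k f (suc i) + Δ^ k g (suc i)) + q * (Δ^ k f i + Δ^ k g i)
      ≡⟨ regroup q (Δ^ k f (suc i)) (Δ^ k g (suc i)) (Δ^ k f i) (Δ^ k g i) ⟩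
    (Δ^ k f (suc i) + q * Δ^ k f i) + (Δ^ k g (suc i) + q * Δ^ k g i) ∎
    where
    open ≡-Reasoning
    h : Seq
    h j = f j + g j
    regroup : ∀ q a b c d → (a + b) + q * (c + d) ≡ (a + q * c) + (b + q * d)
    regroup = solve-∀

  Δ^-const : ∀ k m i → Δ^ k (λ _ → m) i ≡ suc q ^ k * m
  Δ^-const zero    m i = sym (*-identityˡ m)
  Δ^-const (suc k) m i = begin
    Δ^ k (λ _ → m) (suc i) + q * Δ^ k (λ _ → m) i
      ≡⟨ cong₂ (λ x y → x + q * y) (Δ^-const k m (suc i)) (Δ^-const k m i) ⟩
    suc q ^ k * m + q * (suc q ^ k * m)
      ≡⟨ *-assoc (suc q) (suc q ^ k) m ⟨
    suc q ^ suc k * m ∎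
    where open ≡-Reasoning

  Δ^-isolated : ∀ k f → (∀ t → t < k → f (suc t) ≡ 0) → Δ^ k f 0 ≡ q ^ k * f 0
  Δ^-isolated k f f[1+t]≡0 = begin
    Δ^ k f 0
      ≡⟨ Δ^-expansion k (n<1+n k) f 0 ⟩
    1 * q ^ k * f 0 + ∑[ t < k ] (weight k (suc (toℕ t)) * f (suc (toℕ t)))
      ≡⟨ cong₂ _+_ (cong (_* f 0) (*-identityˡ (q ^ k))) (sum-cong-≗ {k} vanish) ⟩
    q ^ k * f 0 + ∑[ t < k ] 0
      ≡⟨ cong (q ^ k * f 0 +_) (sum-replicate-zero k) ⟩
    q ^ k * f 0 + 0
      ≡⟨ +-identityʳ _ ⟩
    q ^ k * f 0 ∎
    where
    open ≡-Reasoning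
    vanish : ∀ t → weight k (suc (toℕ t)) * f (suc (toℕ t)) ≡ 0
    vanish t = trans (cong (weight k (suc (toℕ t)) *_) (f[1+t]≡0 (toℕ t) (toℕ<n t)))
                     (*-zeroʳ (weight k (suc (toℕ t))))

module ModPrime (q : ℕ) (p-prime : Prime (suc q)) where

  p : ℕ
  p = suc q

  open FiniteDifference q
  open Congruence p
  open ≈-Reasoning

  Δ^-cong : ∀ k {f g} → (∀ i → f i ≈ g i) → ∀ i → Δ^ k f i ≈ Δ^ k g i
  Δ^-cong zero    f≈g i = f≈g i
  Δ^-cong (suc k) f≈g i = +-cong (Δ^-cong k f≈g (suc i)) (*-cong (≈-refl {q}) (Δ^-cong k f≈g i))

  Δ^-frobenius : ∀ n .{{_ : NonZero n}} → (∀ t → 0 < t → t < n → p ∣ n C t) →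
                 ∀ f i → Δ^ n f i ≈ q ^ n * f i + f (i + n)
  Δ^-frobenius (suc m) p∣C f i = begin
    Δ^ (suc m) f i
      ≡⟨ Δ^-expansion (suc m) (n<1+n (suc m)) f i ⟩
    first + ∑[ t < suc m ] T (toℕ t)
      ≡⟨ cong (first +_) (sum-init-last {m} (λ t → T (toℕ t))) ⟩
    first + (middle + T (toℕ (fromℕ m)))
      ≡⟨ swap first middle _ ⟩
    middle + (first + T (toℕ (fromℕ m)))
      ≈⟨ +-cong (∣⇒≈0 (∣-∑ (λ t → T (toℕ (inject₁ t))) p∣middle)) ≈-refl ⟩
    first + T (toℕ (fromℕ m))
      ≡⟨ cong₂ _+_ first≡ last≡ ⟩
    q ^ suc m * f i + f (i + suc m) ∎
    where
    T : ℕ → ℕ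
    T t = weight (suc m) (suc t) * f (i + suc t)
    first middle : ℕ
    first = weight (suc m) 0 * f (i + 0)
    middle = ∑[ t < m ] T (toℕ (inject₁ t))
    swap : ∀ x y z → x + (y + z) ≡ y + (x + z)
    swap = solve-∀
    p∣middle : ∀ t → p ∣ T (toℕ (inject₁ t))
    p∣middle t = ∣m⇒∣m*n _ (∣m⇒∣m*n _ (p∣C _ (s≤s z≤n) (s≤s t<m)))
      where
      t<m : toℕ (inject₁ t) < m
      t<m = subst (_< m) (sym (toℕ-inject₁ t)) (toℕ<n t)
    first≡ : first ≡ q ^ suc m * f i
    first≡ = cong₂ _*_ (*-identityˡ (q ^ suc m)) (cong f (+-identityʳ i))
    last≡ : T (toℕ (fromℕ m)) ≡ f (i + suc m)
    last≡ = trans (cong T (toℕ-fromℕ m))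
      (trans (cong₂ (λ c e → c * q ^ e * f (i + suc m)) (nCn≡1 (suc m)) (n∸n≡0 m)) (*-identityˡ _))

  Δ≈0⇒≈const : ∀ g → (∀ i → Δ g i ≈ 0) → ∀ i → g i ≈ g 0
  Δ≈0⇒≈const g Δg≈0 zero    = ≈-refl
  Δ≈0⇒≈const g Δg≈0 (suc i) = begin
    g (suc i)                       ≡⟨ +-identityʳ (g (suc i)) ⟨
    g (suc i) + 0                   ≈⟨ +-cong (≈-refl {g (suc i)}) (∣⇒≈0 (m∣m*n {p} (g i))) ⟨
    g (suc i) + p * g i             ≡⟨ regroup q (g (suc i)) (g i) ⟩
    (g (suc i) + q * g i) + g i     ≈⟨ +-cong (Δg≈0 i) ≈-refl ⟩
    g i                             ≈⟨ Δ≈0⇒≈const g Δg≈0 i ⟩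
    g 0                             ∎
    where
    regroup : ∀ q x y → x + suc q * y ≡ (x + q * y) + y
    regroup = solve-∀

  q*q≈1 : q * q ≈ 1
  q*q≈1 = begin
    q * q                 ≡⟨ +-identityʳ (q * q) ⟨
    q * q + 0             ≈⟨ +-cong (≈-refl {q * q}) (∣⇒≈0 (∣-refl {p})) ⟨
    q * q + p             ≡⟨ regroup q ⟩
    1 + q * p             ≈⟨ +-cong (≈-refl {1}) (∣⇒≈0 (n∣m*n q)) ⟩
    1                     ∎
    where
    regroup : ∀ q → q * q + suc q ≡ 1 + q * suc q
    regroup = solve-∀

  q^m*q^m≈1 : ∀ m → q ^ m * q ^ m ≈ 1
  q^m*q^m≈1 zero    = ≈-refl
  q^m*q^m≈1 (suc m) = begin
    q * q ^ m * (q * q ^ m)     ≡⟨ regroup q (q ^ m) ⟩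
    q * q * (q ^ m * q ^ m)     ≈⟨ *-cong q*q≈1 (q^m*q^m≈1 m) ⟩
    1                           ∎
    where
    regroup : ∀ q x → q * x * (q * x) ≡ q * q * (x * x)
    regroup = solve-∀

  module Nilpotency (a : ℕ) where

    n : ℕ
    n = p ^ a

    instance
      n≢0 : NonZero n
      n≢0 = m^n≢0 p a

    Δ^n-frobenius : ∀ f i → Δ^ n f i ≈ q ^ n * f i + f (i + n)
    Δ^n-frobenius = Δ^-frobenius n (λ t 0<t t<n → p∣nCk a p-prime ∣-refl 0<t t<n)

    q^n+1≈0 : q ^ n + 1 ≈ 0
    q^n+1≈0 = begin
      q ^ n + 1                ≡⟨ cong (_+ 1) (*-identityʳ (q ^ n)) ⟨
      q ^ n * 1 + 1            ≈⟨ Δ^n-frobenius (λ _ → 1) 0 ⟨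
      Δ^ n (λ _ → 1) 0         ≡⟨ Δ^-const n 1 0 ⟩
      p ^ n * 1                ≈⟨ ∣⇒≈0 (∣m⇒∣m*n 1 (m∣m^n p n)) ⟩
      0                        ∎

    Δ^n≈0 : ∀ f → Periodic n f → ∀ i → Δ^ n f i ≈ 0
    Δ^n≈0 f f-periodic i = begin
      Δ^ n f i                    ≈⟨ Δ^n-frobenius f i ⟩
      q ^ n * f i + f (i + n)     ≡⟨ cong (q ^ n * f i +_) (f-periodic i) ⟩
      q ^ n * f i + f i           ≡⟨ cong (q ^ n * f i +_) (*-identityˡ (f i)) ⟨
      q ^ n * f i + 1 * f i       ≡⟨ *-distribʳ-+ (f i) (q ^ n) 1 ⟨
      (q ^ n + 1) * f i           ≈⟨ *-cong q^n+1≈0 (≈-refl {f i}) ⟩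
      0                           ∎

module _ {n m : ℕ} .{{_ : NonZero n}} .{{_ : NonZero m}} where

  finalConfig : Config n m → List (Move n m) → (ℕ → Fin n) → Config n m
  finalConfig c []       rots = c
  finalConfig c (y ∷ ys) rots = finalConfig (rotate (rots 0) (applyMove c y)) ys (λ k → rots (suc k))

  states-++⁺ˡ : ∀ {P : Config n m → Set} c xs ys rots →
                Any P (states c xs rots) → Any P (states c (xs ++ ys) rots)
  states-++⁺ˡ c []       []      rots (here Pc) = here Pc
  states-++⁺ˡ c []       (_ ∷ _) rots (here Pc) = here Pc
  states-++⁺ˡ c (_ ∷ _)  ys      rots (here Pc) = here Pc
  states-++⁺ˡ c (_ ∷ xs) ys      rots (there P) = there (states-++⁺ˡ _ xs ys _ P)

  states-++⁺ʳ : ∀ {P : Config n m → Set} c xs ys rots →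
                Any P (states (finalConfig c xs rots) ys (λ k → rots (length xs + k))) →
                Any P (states c (xs ++ ys) rots)
  states-++⁺ʳ c []       ys rots P = P
  states-++⁺ʳ c (_ ∷ xs) ys rots P = there (states-++⁺ʳ _ xs ys _ P)

  finalConfig-invariant : ∀ {Q : Config n m → Set} c xs rots →
                          All (λ y → ∀ r c → Q c → Q (rotate r (applyMove c y))) xs →
                          Q c → Q (finalConfig c xs rots)
  finalConfig-invariant c []       rots []         Qc = Qc
  finalConfig-invariant c (y ∷ ys) rots (Qy ∷ Qys) Qc =
    finalConfig-invariant _ ys _ Qys (Qy (rots 0) c Qc)

  toℕ-mod : ∀ i → toℕ (i mod n) ≡ i % n
  toℕ-mod i = toℕ-fromℕ< (m%n<n i n)

  mod-cong : ∀ {i j} → i % n ≡ j % n → i mod n ≡ j mod n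
  mod-cong {i} {j} eq = toℕ-injective (trans (toℕ-mod i) (trans eq (sym (toℕ-mod j))))

  toSeq : Config n m → Seq
  toSeq c i = toℕ (c (i mod n))

  toSeq-periodic : ∀ c → Periodic n (toSeq c)
  toSeq-periodic c i = cong (λ j → toℕ (c j)) (mod-cong ([m+n]%n≡m%n i n))

  toSeq-applyMove : ∀ c y i → toSeq (applyMove c y) i ≡ (toSeq c i + toSeq y i) % m
  toSeq-applyMove c y i = toℕ-fromℕ< (m%n<n (toSeq c i + toSeq y i) m)

  toSeq-rotate : ∀ r c i → toSeq (rotate r c) i ≡ toSeq c (i + toℕ r)
  toSeq-rotate r c i = cong (λ j → toℕ (c j)) (mod-cong (begin
    (toℕ (i mod n) + toℕ r) % n   ≡⟨ cong (λ x → (x + toℕ r) % n) (toℕ-mod i) ⟩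
    (i % n + toℕ r) % n           ≡⟨ %-distribˡ-+ (i % n) (toℕ r) n ⟩
    (i % n % n + toℕ r % n) % n   ≡⟨ cong (λ x → (x + toℕ r % n) % n) (m%n%n≡m%n i n) ⟩
    (i % n + toℕ r % n) % n       ≡⟨ %-distribˡ-+ i (toℕ r) n ⟨
    (i + toℕ r) % n               ∎))
    where open ≡-Reasoning

  toSeq≡0⇒AllZero : ∀ c → (∀ i → toSeq c i ≡ 0) → AllZero c
  toSeq≡0⇒AllZero c c≡0 j = trans (cong (λ k → toℕ (c k)) (sym j≡j)) (c≡0 (toℕ j))
    where
    j≡j : toℕ j mod n ≡ j
    j≡j = toℕ-injective (trans (toℕ-mod (toℕ j)) (m<n⇒m%n≡m (toℕ<n j)))

  fromSeq : Seq → Move n m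
  fromSeq f j = f (toℕ j) mod m

  toSeq-fromSeq : ∀ f → Periodic n f → ∀ i → toSeq (fromSeq f) i ≡ f i % m
  toSeq-fromSeq f f-periodic i = begin
    toℕ (f (toℕ (i mod n)) mod m)   ≡⟨ toℕ-fromℕ< (m%n<n (f (toℕ (i mod n))) m) ⟩
    f (toℕ (i mod n)) % m           ≡⟨ cong (λ j → f j % m) (toℕ-mod i) ⟩
    f (i % n) % m                   ≡⟨ cong (_% m) (periodic-% f-periodic i) ⟩
    f i % m                         ∎
    where open ≡-Reasoning

module Strategy (q : ℕ) (p-prime : Prime (suc q)) (a : ℕ) where

  open FiniteDifference q
  open ModPrime q p-prime
  open Congruence p
  open Nilpotency a
  open ≈-Reasoning

  -- Opaque for the same reason as _≈_.
  opaque
    DiffConst : ℕ → ℕ → Config n p → Set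
    DiffConst k t c = ∀ i → Δ^ k (toSeq c) i ≈ t

  -- The height q ^ (n − 1) makes Δ^(n − 1) spike 0 = q ^ (n − 1) * q ^ (n − 1) ≡ 1.
  pulse : ℕ → ℕ
  pulse zero    = q ^ pred n
  pulse (suc _) = 0

  spike : Seq
  spike i = pulse (i % n)

  spike-periodic : Periodic n spike
  spike-periodic i = cong pulse ([m+n]%n≡m%n i n)

  bump : ℕ → Move n p
  bump k = fromSeq (Δ^ (n ∸ suc k) spike)

  toSeq-bump : ∀ k i → toSeq (bump k) i ≈ Δ^ (n ∸ suc k) spike i
  toSeq-bump k i = ≈-trans (≡⇒≈ (toSeq-fromSeq _ (Δ^-periodic (n ∸ suc k) spike-periodic) i)) (%-≈ _)

  opaque
    unfolding DiffConst

    DiffConst-resp : ∀ {k t t′ c} → t ≈ t′ → DiffConst k t c → DiffConst k t′ c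
    DiffConst-resp t≈t′ c-const i = ≈-trans (c-const i) t≈t′

    DiffConst-rotate : ∀ {k t} r c → DiffConst k t c → DiffConst k t (rotate r c)
    DiffConst-rotate {k} {t} r c c-const i = begin
      Δ^ k (toSeq (rotate r c)) i          ≈⟨ Δ^-cong k (λ j → ≡⇒≈ (toSeq-rotate r c j)) i ⟩
      Δ^ k (λ j → toSeq c (j + toℕ r)) i   ≡⟨ Δ^-shift k (toSeq c) (toℕ r) i ⟩
      Δ^ k (toSeq c) (i + toℕ r)           ≈⟨ c-const (i + toℕ r) ⟩
      t                                    ∎

    DiffConst-applyMove : ∀ {k t s} c y → DiffConst k t c → DiffConst k s y →
                          DiffConst k (t + s) (applyMove c y)
    DiffConst-applyMove {k} {t} {s} c y c-const y-const i = begin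
      Δ^ k (toSeq (applyMove c y)) i         ≈⟨ Δ^-cong k toSeq-sum i ⟩
      Δ^ k (λ j → toSeq c j + toSeq y j) i   ≡⟨ Δ^-distrib-+ k (toSeq c) (toSeq y) i ⟩
      Δ^ k (toSeq c) i + Δ^ k (toSeq y) i    ≈⟨ +-cong (c-const i) (y-const i) ⟩
      t + s                                  ∎
      where
      toSeq-sum : ∀ j → toSeq (applyMove c y) j ≈ toSeq c j + toSeq y j
      toSeq-sum j = ≈-trans (≡⇒≈ (toSeq-applyMove c y j)) (%-≈ (toSeq c j + toSeq y j))

    DiffConst⇒DiffConst-suc : ∀ {k t y} → DiffConst k t y → DiffConst (suc k) 0 y
    DiffConst⇒DiffConst-suc {k} {t} {y} y-const i = begin
      Δ^ k (toSeq y) (suc i) + q * Δ^ k (toSeq y) i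
        ≈⟨ +-cong (y-const (suc i)) (*-cong (≈-refl {q}) (y-const i)) ⟩
      p * t
        ≈⟨ ∣⇒≈0 (m∣m*n t) ⟩
      0 ∎

    DiffConst-suc⇒DiffConst : ∀ {k} c → DiffConst (suc k) 0 c → DiffConst k (Δ^ k (toSeq c) 0) c
    DiffConst-suc⇒DiffConst {k} c = Δ≈0⇒≈const (Δ^ k (toSeq c))

    DiffConst-n : ∀ c → DiffConst n 0 c
    DiffConst-n c = Δ^n≈0 (toSeq c) (toSeq-periodic c)

    DiffConst-0⇒AllZero : ∀ c → DiffConst 0 0 c → AllZero c
    DiffConst-0⇒AllZero c c-const = toSeq≡0⇒AllZero c (λ i → ≈⇒≡ (toℕ<n _) (s≤s z≤n) (c-const i))

    DiffConst-bump-suc : ∀ {k} → k < n → DiffConst (suc k) 0 (bump k)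
    DiffConst-bump-suc {k} k<n i = begin
      Δ^ (suc k) (toSeq (bump k)) i         ≈⟨ Δ^-cong (suc k) (toSeq-bump k) i ⟩
      Δ^ (suc k) (Δ^ (n ∸ suc k) spike) i   ≡⟨ cong (λ g → g i) (Δ^-compose (suc k) (n ∸ suc k) spike) ⟨
      Δ^ (suc k + (n ∸ suc k)) spike i      ≡⟨ cong (λ l → Δ^ l spike i) (m+[n∸m]≡n k<n) ⟩
      Δ^ n spike i                          ≈⟨ Δ^n≈0 spike spike-periodic i ⟩
      0                                     ∎

  DiffConst-finalConfig : ∀ {k t} c xs rots → All (DiffConst k 0) xs →
                          DiffConst k t c → DiffConst k t (finalConfig c xs rots)
  DiffConst-finalConfig {k} {t} c xs rots xs-const =
    finalConfig-invariant c xs rots (All.map preserve xs-const)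
    where
    preserve : ∀ {y} → DiffConst k 0 y →
               ∀ r c → DiffConst k t c → DiffConst k t (rotate r (applyMove c y))
    preserve y-const r c c-const = DiffConst-rotate r _
      (DiffConst-resp (≡⇒≈ (+-identityʳ t)) (DiffConst-applyMove c _ c-const y-const))

  DiffConst-bump : ∀ {k} → k < n → DiffConst k 1 (bump k)
  DiffConst-bump {k} k<n =
    DiffConst-resp level≈1 (DiffConst-suc⇒DiffConst (bump k) (DiffConst-bump-suc k<n))
    where
    spike-isolated : ∀ t → t < pred n → spike (suc t) ≡ 0
    spike-isolated t t<n-1 = cong pulse (m<n⇒m%n≡m (subst (suc (suc t) ≤_) (suc-pred n) (s≤s t<n-1)))
    level≈1 : Δ^ k (toSeq (bump k)) 0 ≈ 1
    level≈1 = begin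
      Δ^ k (toSeq (bump k)) 0            ≈⟨ Δ^-cong k (toSeq-bump k) 0 ⟩
      Δ^ k (Δ^ (n ∸ suc k) spike) 0      ≡⟨ cong (λ g → g 0) (Δ^-compose k (n ∸ suc k) spike) ⟨
      Δ^ (k + (n ∸ suc k)) spike 0       ≡⟨ cong (λ l → Δ^ (pred l) spike 0) (m+[n∸m]≡n k<n) ⟩
      Δ^ (pred n) spike 0                ≡⟨ Δ^-isolated (pred n) spike spike-isolated ⟩
      q ^ pred n * pulse (0 % n)         ≡⟨ cong (λ x → q ^ pred n * pulse x) (m<n⇒m%n≡m (>-nonZero⁻¹ n)) ⟩
      q ^ pred n * q ^ pred n            ≈⟨ q^m*q^m≈1 (pred n) ⟩
      1                                  ∎

  strategy : ℕ → List (Move n p)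
  rounds : ℕ → ℕ → List (Move n p)

  strategy zero    = []
  strategy (suc k) = rounds k q

  rounds k zero    = strategy k
  rounds k (suc j) = strategy k ++ bump k ∷ rounds k j

  strategy-moves : ∀ k → k ≤ n → All (DiffConst k 0) (strategy k)
  rounds-moves : ∀ {k} j → k < n → All (DiffConst (suc k) 0) (rounds k j)
  strategy-moves-suc : ∀ {k} → k < n → All (DiffConst (suc k) 0) (strategy k)

  strategy-moves zero    _   = []
  strategy-moves (suc k) k<n = rounds-moves q k<n

  rounds-moves zero    k<n = strategy-moves-suc k<n
  rounds-moves (suc j) k<n = ++⁺ (strategy-moves-suc k<n) (DiffConst-bump-suc k<n ∷ rounds-moves j k<n)

  strategy-moves-suc {k} k<n = All.map DiffConst⇒DiffConst-suc (strategy-moves k (<⇒≤ k<n))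

  rounds-prefix : ∀ {P k c rots} j →
                  Any P (states c (strategy k) rots) → Any P (states c (rounds k j) rots)
  rounds-prefix         zero    P = P
  rounds-prefix {k = k} (suc j) P = states-++⁺ˡ _ (strategy k) _ _ P

  Wins : ℕ → Set
  Wins k = ∀ c → DiffConst k 0 c → ∀ rots → Any AllZero (states c (strategy k) rots)

  rounds-win : ∀ {k} → k < n → Wins k →
               ∀ j s {t} c rots → s ≤ j → t + s ≈ 0 → DiffConst k t c →
               Any AllZero (states c (rounds k j) rots)
  rounds-win {k} k<n win j zero {t} c rots _ t+0≈0 c-const =
    rounds-prefix j (win c (DiffConst-resp t≈0 c-const) rots)
    where
    t≈0 : t ≈ 0
    t≈0 = ≈-trans (≡⇒≈ (sym (+-identityʳ t))) t+0≈0
  rounds-win {k} k<n win (suc j) (suc s) {t} c rots (s≤s s≤j) t+s≈0 c-const =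
    states-++⁺ʳ c (strategy k) (bump k ∷ rounds k j) rots
      (there (rounds-win k<n win j s c′ rots′ s≤j t+1+s≈0 c′-const))
    where
    rots′ : ℕ → Fin n
    rots′ i = rots (length (strategy k) + suc i)
    c₁ c′ : Config n p
    c₁ = finalConfig c (strategy k) rots
    c′ = rotate (rots (length (strategy k) + 0)) (applyMove c₁ (bump k))
    c₁-const : DiffConst k t c₁
    c₁-const = DiffConst-finalConfig c (strategy k) rots (strategy-moves k (<⇒≤ k<n)) c-const
    c′-const : DiffConst k (t + 1) c′
    c′-const = DiffConst-rotate _ _ (DiffConst-applyMove c₁ (bump k) c₁-const (DiffConst-bump k<n))
    t+1+s≈0 : t + 1 + s ≈ 0
    t+1+s≈0 = ≈-trans (≡⇒≈ (+-assoc t 1 s)) t+s≈0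

  strategy-wins : ∀ k → k ≤ n → Wins k
  strategy-wins zero    _   c c-const rots = here (DiffConst-0⇒AllZero c c-const)
  strategy-wins (suc k) k<n c c-const rots =
    rounds-win k<n (strategy-wins k (<⇒≤ k<n)) q s c rots
      (s≤s⁻¹ (m%n<n (q * t) p)) t+s≈0 (DiffConst-suc⇒DiffConst c c-const)
    where
    t s : ℕ
    t = Δ^ k (toSeq c) 0
    s = (q * t) % p
    t+s≈0 : t + s ≈ 0
    t+s≈0 = begin
      t + (q * t) % p   ≈⟨ +-cong (≈-refl {t}) (%-≈ (q * t)) ⟩
      p * t             ≈⟨ ∣⇒≈0 (m∣m*n t) ⟩
      0                 ∎

  canWin : CanWin n p
  canWin = strategy n , λ c rots → strategy-wins n ≤-refl c (DiffConst-n c) rots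

lemma4p1 : (p a : ℕ) (pp : Prime p) → 1 ≤ a →
    CanWin (p ^ a) p {{m^n≢0 p a {{prime⇒nonZero pp}}}} {{prime⇒nonZero pp}}
lemma4p1 (suc q) a pp _ = Strategy.canWin q pp a
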